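{- Let $X$ be a non-empty finite set, $k\ge 1$, and $\mathscr{C}$ a set system on $X$. Then $\mathscr{C}$ is a $k$-weak hierarchy if and only if for every non-empty $A\subseteq X$ there exists $U\subseteq A$ with $|U|\le k$ such that $\mathrm{cl}(A)=\mathrm{cl}(U)$.
   Context: A set system $\mathscr{C}$ on $X$ is a $k$-weak hierarchy if for any $k+1$ sets $A_1,\dots,A_{k+1}\in\mathscr{C}$ there is $j\in\{1,\dots,k+1\}$ with $\bigcap_{i=1}^{k+1}A_i=\bigcap_{i\ne j}A_i$. The closure function of $\mathscr{C}$ is $\mathrm{cl}(A)=\bigcap\{C\in\mathscr{C}\mid A\subseteq C\}$ for $A\subseteq X$ (the intersection of the empty family being $X$). -}

module Defs where

open import Data.Nat using (ℕ; suc)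
open import Data.Fin using (Fin; punchIn)
open import Data.Fin.Subset using (Subset; _⊆_; ⋂)
open import Data.Fin.Subset.Properties using (_⊆?_)
open import Data.List using (List; tabulate; filter)
open import Data.List.Membership.Propositional using (_∈_)
open import Data.Product using (∃)
open import Relation.Binary.PropositionalEquality using (_≡_)

-- A set system on X = Fin n: a finite list of subsets of X
-- (membership in the list = membership in the system).
SetSystem : ℕ → Set
SetSystem n = List (Subset n)

⋂ᶠ : ∀ {n m} → (Fin m → Subset n) → Subset n
⋂ᶠ A = ⋂ (tabulate A)

-- intersection of A_i for i ≠ j (punchIn j enumerates exactly the i ≠ j)
⋂ᶠ-except : ∀ {n m} → Fin (suc m) → (Fin (suc m) → Subset n) → Subset n
⋂ᶠ-except j A = ⋂ᶠ (λ i → A (punchIn j i))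

IsWeakHierarchy : ∀ {n} → ℕ → SetSystem n → Set
IsWeakHierarchy k 𝒞 =
  (A : Fin (suc k) → Subset _) → (∀ i → A i ∈ 𝒞) →
  ∃ λ j → ⋂ᶠ A ≡ ⋂ᶠ-except j A

-- closure: intersection of all C ∈ 𝒞 with A ⊆ C (empty intersection = X)
cl : ∀ {n} → SetSystem n → Subset n → Subset n
cl 𝒞 A = ⋂ (filter (A ⊆?_) 𝒞)

-- If 𝒞 is a k-weak hierarchy, a generating set W of cl A with more than k
-- elements can be thinned: for any k+1 distinct points of W, applying the
-- weak-hierarchy axiom to sets of 𝒞 that contain all of W but one of them shows
-- that some point u is not separated from W - u by any set of 𝒞, so
-- cl W = cl (W - u).  Conversely, if A₁,…,A_{k+1} ∈ 𝒞 violate the axiom, there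
-- are points x_j lying in every A_i except A_j; a generator U of
-- cl {x₁,…,x_{k+1}} with at most k points misses some x_j, hence U ⊆ A_j and
-- x_j ∈ cl U ⊆ A_j, a contradiction.
module Submission where

open import Defs
open import Data.Nat using (ℕ; zero; suc; _≤_; z≤n)
open import Data.Nat.Properties using (≤-refl; ≤-trans; ≤-pred; _≤?_; ≰⇒>; <⇒≱)
open import Data.Bool using (true; false)
open import Data.Fin using (Fin; zero; suc; punchIn; punchOut; inject≤)
open import Data.Fin.Properties
  using (_≟_; any?; all?; ¬∀⟶∃¬; punchInᵢ≢i; punchIn-punchOut; suc-injective;
         injective⇒≤; inject≤-injective)
open import Data.Fin.Subset using (Subset; _⊆_; ∣_∣; Nonempty; _∈_; _∉_; ⋂; _-_)
open import Data.Fin.Subset.Properties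
  using (_⊆?_; _∈?_; ∈⊤; x∈p∩q⁺; x∈p∩q⁻; ⊆-refl; ⊆-antisym; p─q⊆p;
         x∈p∧x≢y⇒x∈p-y; x∈p⇒∣p-x∣<∣p∣)
open import Data.Vec using ([]; _∷_; here; there)
open import Data.List using (List; []; _∷_)
open import Data.List.Relation.Unary.Any as Any using (Any)
open import Data.List.Membership.Propositional using (find; lose)
  renaming (_∈_ to _∈ₗ_)
open import Data.List.Membership.Propositional.Properties
  using (∈-filter⁺; ∈-filter⁻; ∈-tabulate⁺; ∈-tabulate⁻)
open import Data.Product using (∃; _×_; _,_; proj₁; proj₂)
open import Data.Empty using (⊥-elim)
open import Function using (_∘_)
open import Function.Bundles using (_⇔_; mk⇔)
open import Function.Definitions using (Injective)
open import Relation.Nullary using (¬_; Dec; yes; no; does; contradiction)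
open import Relation.Nullary.Decidable using (¬?; _×-dec_; _→-dec_)
open import Relation.Binary.PropositionalEquality
  using (_≡_; _≢_; refl; sym; trans; cong; subst)

module _ {n : ℕ} where

  ∈-⋂⁺ : ∀ {x : Fin n} (L : List (Subset n)) → (∀ {C} → C ∈ₗ L → x ∈ C) → x ∈ ⋂ L
  ∈-⋂⁺ []      h = ∈⊤
  ∈-⋂⁺ (C ∷ L) h = x∈p∩q⁺ (h (Any.here refl) , ∈-⋂⁺ L (h ∘ Any.there))

  ∈-⋂⁻ : ∀ {x : Fin n} {L C} → x ∈ ⋂ L → C ∈ₗ L → x ∈ C
  ∈-⋂⁻ {L = D ∷ L} x∈⋂ (Any.here refl) = proj₁ (x∈p∩q⁻ D (⋂ L) x∈⋂)
  ∈-⋂⁻ {L = D ∷ L} x∈⋂ (Any.there C∈L) = ∈-⋂⁻ (proj₂ (x∈p∩q⁻ D (⋂ L) x∈⋂)) C∈L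

  ∈-⋂ᶠ⁺ : ∀ {m} {x : Fin n} (A : Fin m → Subset n) → (∀ i → x ∈ A i) → x ∈ ⋂ᶠ A
  ∈-⋂ᶠ⁺ {x = x} A h = ∈-⋂⁺ _ (member ∘ ∈-tabulate⁻)
    where
    member : ∀ {C} → ∃ (λ i → C ≡ A i) → x ∈ C
    member (i , refl) = h i

  ∈-⋂ᶠ⁻ : ∀ {m} {x : Fin n} (A : Fin m → Subset n) → x ∈ ⋂ᶠ A → ∀ i → x ∈ A i
  ∈-⋂ᶠ⁻ A x∈⋂ i = ∈-⋂⁻ x∈⋂ (∈-tabulate⁺ i)

  module _ {m : ℕ} (j : Fin (suc m)) (A : Fin (suc m) → Subset n) where

    ∈-⋂ᶠ-except⁺ : ∀ {x} → (∀ i → i ≢ j → x ∈ A i) → x ∈ ⋂ᶠ-except j A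
    ∈-⋂ᶠ-except⁺ h = ∈-⋂ᶠ⁺ _ λ i → h (punchIn j i) (punchInᵢ≢i j i)

    ∈-⋂ᶠ-except⁻ : ∀ {x} → x ∈ ⋂ᶠ-except j A → ∀ i → i ≢ j → x ∈ A i
    ∈-⋂ᶠ-except⁻ {x} x∈⋂ i i≢j =
      subst (λ i → x ∈ A i) (punchIn-punchOut j≢i) (∈-⋂ᶠ⁻ _ x∈⋂ (punchOut j≢i))
      where
      j≢i : j ≢ i
      j≢i = i≢j ∘ sym

    ⋂ᶠ≡⋂ᶠ-except : ⋂ᶠ-except j A ⊆ A j → ⋂ᶠ A ≡ ⋂ᶠ-except j A
    ⋂ᶠ≡⋂ᶠ-except ⋂ᶠ-except⊆Aj = ⊆-antisym
      (λ x∈⋂ → ∈-⋂ᶠ-except⁺ (λ i _ → ∈-⋂ᶠ⁻ A x∈⋂ i))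
      (λ x∈⋂ → ∈-⋂ᶠ⁺ A λ i → member x∈⋂ i (i ≟ j))
      where
      member : ∀ {x} → x ∈ ⋂ᶠ-except j A → ∀ i → Dec (i ≡ j) → x ∈ A i
      member x∈⋂ i (yes refl) = ⋂ᶠ-except⊆Aj x∈⋂
      member x∈⋂ i (no i≢j)   = ∈-⋂ᶠ-except⁻ x∈⋂ i i≢j

  ⊈⇒∃∉ : ∀ {p q : Subset n} → ¬ p ⊆ q → ∃ λ x → x ∈ p × x ∉ q
  ⊈⇒∃∉ {p} {q} p⊈q with ¬∀⟶∃¬ n _ (λ x → (x ∈? p) →-dec (x ∈? q)) (λ h → p⊈q (h _))
  ... | x , x∈p↛x∈q with x ∈? p
  ...   | yes x∈p = x , x∈p , x∈p↛x∈q ∘ (λ x∈q _ → x∈q)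
  ...   | no  x∉p = contradiction (λ x∈p → contradiction x∈p x∉p) x∈p↛x∈q

module _ {n : ℕ} (𝒞 : SetSystem n) where

  ∈-cl⁺ : ∀ {A x} → (∀ {C} → C ∈ₗ 𝒞 → A ⊆ C → x ∈ C) → x ∈ cl 𝒞 A
  ∈-cl⁺ {A} h = ∈-⋂⁺ _ λ C∈ → let C∈𝒞 , A⊆C = ∈-filter⁻ (A ⊆?_) C∈ in h C∈𝒞 A⊆C

  cl-least : ∀ {A C} → C ∈ₗ 𝒞 → A ⊆ C → cl 𝒞 A ⊆ C
  cl-least {A} C∈𝒞 A⊆C x∈cl = ∈-⋂⁻ x∈cl (∈-filter⁺ (A ⊆?_) C∈𝒞 A⊆C)

  cl-extensive : ∀ A → A ⊆ cl 𝒞 A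
  cl-extensive A x∈A = ∈-cl⁺ λ _ A⊆C → A⊆C x∈A

  cl-≡ : ∀ {A B} → B ⊆ A → (∀ {C} → C ∈ₗ 𝒞 → B ⊆ C → A ⊆ C) → cl 𝒞 A ≡ cl 𝒞 B
  cl-≡ B⊆A B⊆C⇒A⊆C = ⊆-antisym
    (λ x∈clA → ∈-cl⁺ λ C∈𝒞 B⊆C → cl-least C∈𝒞 (B⊆C⇒A⊆C C∈𝒞 B⊆C) x∈clA)
    (λ x∈clB → ∈-cl⁺ λ C∈𝒞 A⊆C → cl-least C∈𝒞 (A⊆C ∘ B⊆A) x∈clB)

enum : ∀ {n} (p : Subset n) → Fin ∣ p ∣ → Fin n
enum (true  ∷ p) zero    = zero
enum (true  ∷ p) (suc i) = suc (enum p i)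
enum (false ∷ p) i       = suc (enum p i)

enum-∈ : ∀ {n} (p : Subset n) i → enum p i ∈ p
enum-∈ (true  ∷ p) zero    = here
enum-∈ (true  ∷ p) (suc i) = there (enum-∈ p i)
enum-∈ (false ∷ p) i       = there (enum-∈ p i)

enum-injective : ∀ {n} (p : Subset n) → Injective _≡_ _≡_ (enum p)
enum-injective (true  ∷ p) {zero}  {zero}  _  = refl
enum-injective (true  ∷ p) {suc i} {suc j} eq = cong suc (enum-injective p (suc-injective eq))
enum-injective (false ∷ p)                 eq = enum-injective p (suc-injective eq)

index : ∀ {n} (p : Subset n) {x} → x ∈ p → Fin ∣ p ∣
index (true  ∷ p) here      = zero
index (true  ∷ p) (there h) = suc (index p h)
index (false ∷ p) (there h) = index p h

enum-index : ∀ {n} (p : Subset n) {x} (x∈p : x ∈ p) → enum p (index p x∈p) ≡ x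
enum-index (true  ∷ p) here      = refl
enum-index (true  ∷ p) (there h) = cong suc (enum-index p h)
enum-index (false ∷ p) (there h) = cong suc (enum-index p h)

module _ {n m : ℕ} {p : Subset n} where

  injectionInto⇒≤∣p∣ : ∀ {f : Fin m → Fin n} →
    Injective _≡_ _≡_ f → (f∈p : ∀ i → f i ∈ p) → m ≤ ∣ p ∣
  injectionInto⇒≤∣p∣ {f} f-inj f∈p = injective⇒≤ {f = index p ∘ f∈p} λ {i} {j} eq →
    f-inj (trans (sym (enum-index p (f∈p i)))
          (trans (cong (enum p) eq) (enum-index p (f∈p j))))

  ≤∣p∣⇒injectionInto : m ≤ ∣ p ∣ →
    ∃ λ (f : Fin m → Fin n) → Injective _≡_ _≡_ f × (∀ i → f i ∈ p)
  ≤∣p∣⇒injectionInto m≤∣p∣ =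
      enum p ∘ (λ i → inject≤ i m≤∣p∣)
    , inject≤-injective m≤∣p∣ m≤∣p∣ _ _ ∘ enum-injective p
    , λ i → enum-∈ p _

fromDec : ∀ {n} {P : Fin n → Set} → (∀ y → Dec (P y)) → Subset n
fromDec {zero}  P? = []
fromDec {suc n} P? = does (P? zero) ∷ fromDec (P? ∘ suc)

∈-fromDec⁺ : ∀ {n} {P : Fin n → Set} (P? : ∀ y → Dec (P y)) {y} → P y → y ∈ fromDec P?
∈-fromDec⁺ P? {zero} Py with P? zero
... | yes _   = here
... | no ¬Py  = contradiction Py ¬Py
∈-fromDec⁺ P? {suc y} Py = there (∈-fromDec⁺ (P? ∘ suc) Py)

∈-fromDec⁻ : ∀ {n} {P : Fin n → Set} (P? : ∀ y → Dec (P y)) {y} → y ∈ fromDec P? → P y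
∈-fromDec⁻ P? {zero} y∈ with P? zero | y∈
... | yes Py | _ = Py
∈-fromDec⁻ P? {suc y} (there y∈) = ∈-fromDec⁻ (P? ∘ suc) y∈

image : ∀ {m n} → (Fin m → Fin n) → Subset n
image f = fromDec λ y → any? λ i → y ≟ f i

Separates : ∀ {n} → Subset n → Fin n → Subset n → Set
Separates W u C = W - u ⊆ C × u ∉ C

separates? : ∀ {n} W (u : Fin n) C → Dec (Separates W u C)
separates? W u C = (W - u ⊆? C) ×-dec ¬? (u ∈? C)

module _ {n : ℕ} {𝒞 : SetSystem n} where

  cl-remove-unseparated : ∀ {W u} → ¬ Any (Separates W u) 𝒞 → cl 𝒞 W ≡ cl 𝒞 (W - u)
  cl-remove-unseparated {W} {u} unseparated = cl-≡ 𝒞 (p─q⊆p W _) W⊆C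
    where
    W⊆C : ∀ {C} → C ∈ₗ 𝒞 → W - u ⊆ C → W ⊆ C
    W⊆C {C} C∈𝒞 W-u⊆C {z} z∈W with z ≟ u | u ∈? C
    ... | no z≢u  | _       = W-u⊆C (x∈p∧x≢y⇒x∈p-y z∈W z≢u)
    ... | yes refl | yes u∈C = u∈C
    ... | yes refl | no u∉C  = contradiction (lose C∈𝒞 ((λ {_} → W-u⊆C) , u∉C)) unseparated

  module _ {k : ℕ} (weakHierarchy : IsWeakHierarchy k 𝒞) where

    weakHierarchy⇒unseparated : ∀ {W} (u : Fin (suc k) → Fin n) →
      Injective _≡_ _≡_ u → (∀ j → u j ∈ W) →
      ∃ λ j → ¬ Any (Separates W (u j)) 𝒞
    weakHierarchy⇒unseparated {W} u u-inj u∈W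
      with all? (λ j → Any.any? (separates? W (u j)) 𝒞)
    ... | no ¬allSeparated = ¬∀⟶∃¬ _ _ (λ j → Any.any? (separates? W (u j)) 𝒞) ¬allSeparated
    ... | yes allSeparated = ⊥-elim (proj₂ (C-separates j) (∈-⋂ᶠ⁻ C uj∈⋂C j))
      where
      C : Fin (suc k) → Subset n
      C j = proj₁ (find (allSeparated j))
      C-separates : ∀ j → Separates W (u j) (C j)
      C-separates j = proj₂ (proj₂ (find (allSeparated j)))
      j : Fin (suc k)
      j = proj₁ (weakHierarchy C (proj₁ ∘ proj₂ ∘ find ∘ allSeparated))
      uj∈⋂C : u j ∈ ⋂ᶠ C
      uj∈⋂C = subst (u j ∈_) (sym (proj₂ (weakHierarchy C _)))
        (∈-⋂ᶠ-except⁺ j C λ i i≢j →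
          proj₁ (C-separates i) (x∈p∧x≢y⇒x∈p-y (u∈W j) (i≢j ∘ sym ∘ u-inj)))

    shrink : ∀ t W → ∣ W ∣ ≤ t → ∃ λ U → U ⊆ W × ∣ U ∣ ≤ k × cl 𝒞 W ≡ cl 𝒞 U
    shrink t W ∣W∣≤t with ∣ W ∣ ≤? k
    ... | yes ∣W∣≤k = W , ⊆-refl , ∣W∣≤k , refl
    shrink zero W ∣W∣≤0 | no ∣W∣≰k = contradiction (≤-trans ∣W∣≤0 z≤n) ∣W∣≰k
    shrink (suc t) W ∣W∣≤1+t | no ∣W∣≰k
      with ≤∣p∣⇒injectionInto (≰⇒> ∣W∣≰k)
    ... | u , u-inj , u∈W with weakHierarchy⇒unseparated u u-inj u∈W
    ... | j , unseparated
      with shrink t (W - u j) (≤-pred (≤-trans (x∈p⇒∣p-x∣<∣p∣ (u∈W j)) ∣W∣≤1+t))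
    ... | U , U⊆W-uj , ∣U∣≤k , eq =
      U , p─q⊆p W _ ∘ U⊆W-uj , ∣U∣≤k , trans (cl-remove-unseparated unseparated) eq

  module _ {k : ℕ} {A : Fin (suc k) → Subset n} (A∈𝒞 : ∀ i → A i ∈ₗ 𝒞)
           {x : Fin (suc k) → Fin n}
           (x∈A : ∀ i j → i ≢ j → x i ∈ A j) (x∉A : ∀ j → x j ∉ A j) where

    private-point-injective : Injective _≡_ _≡_ x
    private-point-injective {i} {j} xi≡xj with i ≟ j
    ... | yes i≡j = i≡j
    ... | no  i≢j = contradiction (subst (_∈ A j) xi≡xj (x∈A i j i≢j)) (x∉A j)

    private-point-∈-generator : ∀ {U} → U ⊆ image x → cl 𝒞 (image x) ≡ cl 𝒞 U →
      ∀ j → x j ∈ U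
    private-point-∈-generator {U} U⊆image cl-eq j with x j ∈? U
    ... | yes xj∈U = xj∈U
    ... | no  xj∉U = contradiction xj∈Aj (x∉A j)
      where
      U⊆Aj : U ⊆ A j
      U⊆Aj y∈U with ∈-fromDec⁻ _ (U⊆image y∈U)
      ... | i , refl with i ≟ j
      ...   | yes refl = contradiction y∈U xj∉U
      ...   | no  i≢j  = x∈A i j i≢j
      xj∈Aj : x j ∈ A j
      xj∈Aj = cl-least 𝒞 (A∈𝒞 j) U⊆Aj
        (subst (x j ∈_) cl-eq (cl-extensive 𝒞 _ (∈-fromDec⁺ _ (j , refl))))

    image-has-no-small-generator :
      ¬ ∃ λ U → U ⊆ image x × ∣ U ∣ ≤ k × cl 𝒞 (image x) ≡ cl 𝒞 U
    image-has-no-small-generator (U , U⊆image , ∣U∣≤k , cl-eq) = <⇒≱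
      (injectionInto⇒≤∣p∣ private-point-injective
        (private-point-∈-generator U⊆image cl-eq))
      ∣U∣≤k

  generators⇒weakHierarchy : ∀ {k} →
    (∀ A → Nonempty A → ∃ λ U → U ⊆ A × ∣ U ∣ ≤ k × cl 𝒞 A ≡ cl 𝒞 U) →
    IsWeakHierarchy k 𝒞
  generators⇒weakHierarchy {k} generators A A∈𝒞
    with any? (λ j → ⋂ᶠ-except j A ⊆? A j)
  ... | yes (j , ⋂ᶠ-except⊆Aj) = j , ⋂ᶠ≡⋂ᶠ-except j A ⋂ᶠ-except⊆Aj
  ... | no ¬∃⊆ = ⊥-elim (image-has-no-small-generator A∈𝒞 x∈A x∉A
                          (generators (image x) (x zero , ∈-fromDec⁺ _ (zero , refl))))
    where
    private-point : ∀ j → ∃ λ y → y ∈ ⋂ᶠ-except j A × y ∉ A j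
    private-point j = ⊈⇒∃∉ λ E⊆Aj → ¬∃⊆ (j , E⊆Aj)
    x : Fin (suc k) → Fin n
    x = proj₁ ∘ private-point
    x∈A : ∀ i j → i ≢ j → x i ∈ A j
    x∈A i j i≢j = ∈-⋂ᶠ-except⁻ i A (proj₁ (proj₂ (private-point i))) j (i≢j ∘ sym)
    x∉A : ∀ j → x j ∉ A j
    x∉A = proj₂ ∘ proj₂ ∘ private-point

proposition1 : (m : ℕ) → (k : ℕ) → 1 ≤ k → (𝒞 : SetSystem (suc m)) →
    IsWeakHierarchy k 𝒞 ⇔
      ((A : Subset (suc m)) → Nonempty A →
        ∃ λ U → U ⊆ A × ∣ U ∣ ≤ k × cl 𝒞 A ≡ cl 𝒞 U)
proposition1 m k _ 𝒞 = mk⇔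
  (λ weakHierarchy A _ → shrink weakHierarchy ∣ A ∣ A ≤-refl)
  generators⇒weakHierarchy
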